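{- Let $T$ be a weakly decreasing Schröder tree with $k$ leaves, and let $\prec$ be a uniform linear ordering of $[k]^n$ whose induced ordering on $[k]$ is the usual ordering $<$, and such that for all $a<b$, $c<d$ in $[k]$: $cb\prec da$ (in the common restriction of $\prec$ to $2$-subcubes) if and only if $[a,b]_T\preceq_T[c,d]_T$. Then for every $(n-1)$-subcube $C$ of $[k]^n$, the restrictions of $\prec$ and of $\prec_T$ to $C$ coincide.
   Context: Elements of $[k]^n$ are words over $[k]=\{1,\dotsc,k\}$. A $d$-parameter word of length $n$ is a word $p$ over $[k]\cup\{*_1,\dotsc,*_d\}$ containing each $*_i$; $p[w]$ replaces each $*_i$ by $w_i$; $\{p[w]:w\in[k]^d\}$ is a $d$-subcube. Canonical words have first occurrences of $*_1,\dotsc,*_d$ in order; each subcube has a unique canonical word $p$, giving the canonical bijection $w\mapsto p[w]$. The restriction of $\prec$ to a subcube is the ordering of $[k]^d$ with $w\prec w'$ iff $p[w]\prec p[w']$; $\prec$ is uniform if for each $d$ all restrictions to $d$-subcubes coincide; its induced ordering on $[k]$ is the common restriction to $1$-subcubes. A Schröder tree is a rooted plane tree with every internal node having at least 2 children; weakly decreasing means it carries a total preorder $\preceq_T$ on internal nodes with every path from the root strictly decreasing. Leaves are labeled $1,\dotsc,k$ from left to right; $[a,b]_T$ is the lowest internal node having leaves $a,b$ as descendants. The ordering $\prec_T$ on $[k]^n$: for distinct $w,w'$, let $i$ be the smallest index with $w_i\ne w'_i$ such that $[w_j,w'_j]_T\preceq_T[w_i,w'_i]_T$ for all $j$ with $w_j\ne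 w'_j$; then $w\prec_T w'$ iff $w_i<w'_i$. -}

module Defs where

open import Level using (0ℓ)
open import Data.Nat as ℕ using (ℕ; zero; suc)
open import Data.Fin as Fin using (Fin; splitAt)
open import Data.Vec using (Vec; []; _∷_; lookup; map)
open import Data.Vec.Membership.Propositional using (_∈_)
open import Data.Sum using (_⊎_; inj₁; inj₂; [_,_]′)
open import Data.Maybe as Maybe using (Maybe; just; nothing; maybe′)
open import Data.Product using (Σ; ∃; ∃-syntax; _×_; _,_)
open import Function using (id)
open import Function.Bundles using (_⇔_)
open import Relation.Binary using (Rel; IsTotalPreorder; IsStrictTotalOrder)
open import Relation.Binary.PropositionalEquality using (_≡_; _≢_)
open import Relation.Nullary using (¬_)

-- Letters [k] = Fin k (1,…,k ↦ 0,…,k-1, usual order = Fin._<_).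
Word : ℕ → ℕ → Set
Word k n = Vec (Fin k) n

-- A d-parameter word over [k]: letters are inj₁ a (a ∈ [k]) or inj₂ i (= *_i).
PWord : ℕ → ℕ → ℕ → Set
PWord k d n = Vec (Fin k ⊎ Fin d) n

ContainsAll : ∀ {k d n} → PWord k d n → Set
ContainsAll {d = d} p = (i : Fin d) → inj₂ i ∈ p

FirstOcc : ∀ {k d n} → PWord k d n → Fin d → Fin n → Set
FirstOcc p i pos = lookup p pos ≡ inj₂ i × (∀ pos′ → pos′ Fin.< pos → lookup p pos′ ≢ inj₂ i)

record Canonical {k d n : ℕ} (p : PWord k d n) : Set where
  field
    containsAll : ContainsAll p
    ordered     : ∀ i j pi pj → i Fin.< j → FirstOcc p i pi → FirstOcc p j pj → pi Fin.< pj

_[_] : ∀ {k d n} → PWord k d n → Word k d → Word k n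
p [ w ] = map [ id , lookup w ]′ p

Restrict : ∀ {k d n} → Rel (Word k n) 0ℓ → PWord k d n → Rel (Word k d) 0ℓ
Restrict _≺_ p w w′ = (p [ w ]) ≺ (p [ w′ ])

Uniform : ∀ {k n} → Rel (Word k n) 0ℓ → Set
Uniform {k} {n} _≺_ = ∀ d (p q : PWord k d n) → Canonical p → Canonical q →
  ∀ w w′ → Restrict _≺_ p w w′ ⇔ Restrict _≺_ q w w′

InducedUsual : ∀ {k n} → Rel (Word k n) 0ℓ → Set
InducedUsual {k} {n} _≺_ = ∀ (p : PWord k 1 n) → Canonical p →
  ∀ (a b : Fin k) → Restrict _≺_ p (a ∷ []) (b ∷ []) ⇔ (a Fin.< b)

-- Schröder trees (rooted plane trees, every internal node ≥ 2 children),
-- indexed by the number of leaves. Leaves are numbered left to right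
-- by Fin l (via splitAt).

data Tree : ℕ → Set
data Forest : ℕ → ℕ → Set   -- Forest c l : c trees, l leaves in total

data Tree where
  leaf : Tree 1
  node : ∀ {c l} → Forest (suc (suc c)) l → Tree l

data Forest where
  []  : Forest 0 0
  _∷_ : ∀ {c a b} → Tree a → Forest c b → Forest (suc c) (a ℕ.+ b)

-- internal nodes (positions of `node`s)
data INode : ∀ {l} → Tree l → Set
data FINode : ∀ {c l} → Forest c l → Set

data INode where
  here  : ∀ {c l} {f : Forest (suc (suc c)) l} → INode (node f)
  there : ∀ {c l} {f : Forest (suc (suc c)) l} → FINode f → INode (node f)

data FINode where
  hd : ∀ {c a b} {t : Tree a} {f : Forest c b} → INode t → FINode (t ∷ f)
  tl : ∀ {c a b} {t : Tree a} {f : Forest c b} → FINode f → FINode (t ∷ f)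

data RootOf : ∀ {c l} {f : Forest c l} → FINode f → Set where
  hd-root : ∀ {c c′ a b} {g : Forest (suc (suc c′)) a} {f : Forest c b} →
            RootOf {f = node g ∷ f} (hd here)
  tl-root : ∀ {c a b} {t : Tree a} {f : Forest c b} {p : FINode f} →
            RootOf p → RootOf {f = t ∷ f} (tl p)

-- Child v u : internal node v is a child of internal node u
data Child : ∀ {l} {t : Tree l} → INode t → INode t → Set
data FChild : ∀ {c l} {f : Forest c l} → FINode f → FINode f → Set

data Child where
  top  : ∀ {c l} {f : Forest (suc (suc c)) l} {p : FINode f} →
         RootOf p → Child {t = node f} (there p) here
  down : ∀ {c l} {f : Forest (suc (suc c)) l} {p q : FINode f} →
         FChild p q → Child {t = node f} (there p) (there q)

data FChild where
  hd-ch : ∀ {c a b} {t : Tree a} {f : Forest c b} {v u : INode t} →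
          Child v u → FChild {f = t ∷ f} (hd v) (hd u)
  tl-ch : ∀ {c a b} {t : Tree a} {f : Forest c b} {p q : FINode f} →
          FChild p q → FChild {f = t ∷ f} (tl p) (tl q)

-- lowest internal node having leaves x, y as descendants (if any)
tlca : ∀ {l} (t : Tree l) → Fin l → Fin l → Maybe (INode t)
-- inside a forest: the lowest internal node strictly below the forest's
-- roots' level, i.e. inside one of its trees, having both leaves below;
-- nothing if the leaves lie in different trees (or in the same leaf)
flca : ∀ {c l} (f : Forest c l) → Fin l → Fin l → Maybe (FINode f)

tlca leaf     x y = nothing
tlca (node f) x y = just (maybe′ there here (flca f x y))

flca [] () y
flca (_∷_ {a = a} t f) x y with splitAt a x | splitAt a y
... | inj₁ x′ | inj₁ y′ = Maybe.map hd (tlca t x′ y′)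
... | inj₂ x′ | inj₂ y′ = Maybe.map tl (flca f x′ y′)
... | inj₁ _  | inj₂ _  = nothing
... | inj₂ _  | inj₁ _  = nothing

record WDSchroeder (k : ℕ) : Set₁ where
  field
    tree            : Tree k
    _⪯_             : Rel (INode tree) 0ℓ
    isTotalPreorder : IsTotalPreorder _≡_ _⪯_
    decreasing      : ∀ u v → Child v u → (v ⪯ u) × ¬ (u ⪯ v)

module _ {k : ℕ} (T : WDSchroeder k) where
  open WDSchroeder T

  -- [a,b]_T ⪯_T [c,d]_T
  LcaLe : Fin k → Fin k → Fin k → Fin k → Set
  LcaLe a b c d = ∃[ u ] ∃[ v ] (tlca tree a b ≡ just u × tlca tree c d ≡ just v × u ⪯ v)

  MaxPos : ∀ {n} → Word k n → Word k n → Fin n → Set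
  MaxPos w w′ i = lookup w i ≢ lookup w′ i ×
    (∀ j → lookup w j ≢ lookup w′ j →
       LcaLe (lookup w j) (lookup w′ j) (lookup w i) (lookup w′ i))

  _≺T_ : ∀ {n} → Rel (Word k n) 0ℓ
  w ≺T w′ = ∃[ i ] (MaxPos w w′ i × (∀ j → j Fin.< i → ¬ MaxPos w w′ j) ×
                   lookup w i Fin.< lookup w′ i)

module Submission where

open import Defs
open import Level using (0ℓ)
open import Data.Nat using (ℕ; suc)
open import Data.Fin as Fin using (Fin)
open import Data.Vec using (Vec; []; _∷_)
open import Function.Bundles using (_⇔_)
open import Relation.Binary using (Rel; IsStrictTotalOrder)
open import Relation.Binary.PropositionalEquality using (_≡_)

open import Data.Bool using (Bool; true; false; if_then_else_)
open import Data.Empty using (⊥-elim)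
open import Data.Fin using (zero; suc; toℕ; inject₁; punchIn; punchOut; pinch; splitAt)
import Data.Fin.Properties as FinP
open import Data.Maybe as Maybe using (just; maybe′)
import Data.Nat as ℕ
import Data.Nat.Properties as ℕP
open import Data.Product using (∃-syntax; _×_; _,_; proj₁; proj₂)
open import Data.Sum using (_⊎_; inj₁; inj₂; [_,_]′) renaming (map to ⊎-map)
open import Data.Sum.Properties using () renaming (≡-dec to ⊎-≡-dec)
open import Data.Vec using (lookup; tabulate; insertAt; removeAt)
import Data.Vec.Properties as VecP
import Data.Vec.Relation.Unary.Any as Any
open import Data.Vec.Relation.Unary.Any.Properties using (lookup-index)
open import Data.Vec.Membership.Propositional using (_∈_)
open import Data.Vec.Membership.Propositional.Properties using (∈-lookup)
open import Function using (id; _∘_)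
open import Function.Bundles using (mk⇔; Equivalence)
import Function.Properties.Equivalence as ⇔
open import Relation.Binary using (IsTotalPreorder; tri<; tri≈; tri>)
open import Relation.Binary.PropositionalEquality
  using (_≢_; refl; sym; trans; cong; subst; subst₂; module ≡-Reasoning)
open import Relation.Nullary using (¬_; Dec; yes; no; does)
open import Relation.Nullary.Decidable using (map′; dec-true; dec-false; _⊎-dec_)

-- Write ⊏ for ≺_T, N = m+1 for the word length, and call a pair v, v′ of
-- [k]^e faithful on an e-parameter word r if  r[v] ≺ r[v′] ⇔ v ⊏ v′.
-- The proof is the paper's induction on the dimension of subcubes.
--  * ⊏ is uniform (restrict-⊏), and ⊏ is a strict total order: the 2-subcube
--    hypothesis makes ⪯_T decidable, so first maximal positions can be
--    found by finite search (Trichotomy).  Hence faithfulness on a canonical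
--    word does not depend on the word (transfer), and the inclusion
--    v ⊏ v′ ⇒ r[v] ≺ r[v′] already gives faithfulness (faithful-from).
--  * We show that all pairs are faithful on the standard word *₁…*ₑ c…c,
--    for e = 1, …, N-1.  Pairs agreeing in a coordinate reduce to dimension
--    e-1 by fixing it (fixing).  Dimension 1 is the induced order, dimension
--    2 the 2-subcube hypothesis.  For e ≥ 3 the decisive coordinate i of
--    v ⊏ v′ is duplicated (an (e+1)-letter word, so e < N is needed here) and
--    dup i v ≺ dup i v′ is shown through a hybrid word (Hybrid, Middle), both
--    steps agreeing in two coordinates and hence being of dimension e-1.
--  * lemma11 is the case e = m, transferred to the given canonical word.

lookup-ext : ∀ {A : Set} {n} {xs ys : Vec A n} →
             (∀ i → lookup xs i ≡ lookup ys i) → xs ≡ ys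
lookup-ext {xs = xs} {ys} same = begin
  xs                  ≡⟨ sym (VecP.tabulate∘lookup xs) ⟩
  tabulate (lookup xs) ≡⟨ VecP.tabulate-cong same ⟩
  tabulate (lookup ys) ≡⟨ VecP.tabulate∘lookup ys ⟩
  ys                  ∎
  where open ≡-Reasoning

least : ∀ {n} (P : Fin n → Set) → (∀ i → Dec (P i)) → ∀ j → P j →
        ∃[ i ] (P i × (∀ i′ → i′ Fin.< i → ¬ P i′))
least P P? zero    p = zero , p , λ _ ()
least P P? (suc j) p with P? zero
... | yes p₀ = zero , p₀ , λ _ ()
... | no ¬p₀ with least (P ∘ suc) (P? ∘ suc) j p
...   | i , pᵢ , below =
  suc i , pᵢ , λ { zero _ → ¬p₀ ; (suc i′) (ℕ.s≤s i′<i) → below i′ i′<i }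

maximum : ∀ {n} (D : Fin n → Set) (R : Fin n → Fin n → Set) → (∀ i → Dec (D i)) →
          (∀ i j → D i → D j → R i j ⊎ R j i) → (∀ i j l → R i j → R j l → R i l) →
          ∀ j → D j → ∃[ M ] (D M × (∀ i → D i → R i M))
maximum {suc n} D R D? total trans′ j dⱼ with FinP.any? (D? ∘ suc) | j
... | no empty | zero    = zero , dⱼ , λ { zero _ → [ id , id ]′ (total zero zero dⱼ dⱼ)
                                          ; (suc i) dᵢ → ⊥-elim (empty (i , dᵢ)) }
... | no empty | suc j′  = ⊥-elim (empty (j′ , dⱼ))
... | yes (j′ , dⱼ′) | _
  with maximum (D ∘ suc) (λ a b → R (suc a) (suc b)) (D? ∘ suc)
         (λ a b → total (suc a) (suc b)) (λ a b c → trans′ (suc a) (suc b) (suc c)) j′ dⱼ′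
     | D? zero
...   | M , d , above | no ¬d₀ =
  suc M , d , λ { zero d₀ → ⊥-elim (¬d₀ d₀) ; (suc i) dᵢ → above i dᵢ }
...   | M , d , above | yes d₀ with total zero (suc M) d₀ d
...     | inj₁ 0≤M = suc M , d , λ { zero _ → 0≤M ; (suc i) dᵢ → above i dᵢ }
...     | inj₂ M≤0 = zero , d₀ , λ { zero _ → [ id , id ]′ (total zero zero d₀ d₀)
                                    ; (suc i) dᵢ → trans′ _ _ _ (above i dᵢ) M≤0 }

-- A trichotomous relation contained in an irreflexive transitive one is all
-- of it; so a strict order is determined by one inclusion.
included-trichotomous : ∀ {A : Set} (_<_ _<′_ : A → A → Set) →
  (∀ x → ¬ x <′ x) → (∀ x y z → x <′ y → y <′ z → x <′ z) →
  (∀ x y → x ≡ y ⊎ x < y ⊎ y < x) → (∀ x y → x < y → x <′ y) →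
  ∀ x y → x <′ y → x < y
included-trichotomous _<_ _<′_ irrefl trans′ tri incl x y x<′y with tri x y
... | inj₁ refl        = ⊥-elim (irrefl x x<′y)
... | inj₂ (inj₁ x<y) = x<y
... | inj₂ (inj₂ y<x) = ⊥-elim (irrefl x (trans′ x y x x<′y (incl y x y<x)))

tlca-sym : ∀ {l} (t : Tree l) x y → tlca t x y ≡ tlca t y x
flca-sym : ∀ {c l} (f : Forest c l) x y → flca f x y ≡ flca f y x
tlca-sym leaf     x y = refl
tlca-sym (node f) x y = cong (λ u → just (maybe′ there here u)) (flca-sym f x y)
flca-sym (_∷_ {a = a} t f) x y with splitAt a x | splitAt a y
... | inj₁ x′ | inj₁ y′ = cong (Maybe.map hd) (tlca-sym t x′ y′)
... | inj₂ x′ | inj₂ y′ = cong (Maybe.map tl) (flca-sym f x′ y′)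
... | inj₁ _  | inj₂ _  = refl
... | inj₂ _  | inj₁ _  = refl

tlca-distinct : ∀ {l} (t : Tree l) x y → x ≢ y → ∃[ u ] (tlca t x y ≡ just u)
tlca-distinct leaf     zero zero x≢y = ⊥-elim (x≢y refl)
tlca-distinct (node f) x    y    _   = _ , refl

lookup-subst : ∀ {k e n} (r : PWord k e n) (v : Word k e) j →
               lookup (r [ v ]) j ≡ [ id , lookup v ]′ (lookup r j)
lookup-subst r v j = VecP.lookup-map j _ r

lookup-subst-param : ∀ {k e n} (r : PWord k e n) (v : Word k e) {j s} →
                     lookup r j ≡ inj₂ s → lookup (r [ v ]) j ≡ lookup v s
lookup-subst-param r v {j} rⱼ = trans (lookup-subst r v j) (cong [ id , lookup v ]′ rⱼ)

constant-or-param : ∀ {k e n} (r : PWord k e n) j →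
                    (∀ v v′ → lookup (r [ v ]) j ≡ lookup (r [ v′ ]) j) ⊎
                    ∃[ s ] (lookup r j ≡ inj₂ s)
constant-or-param r j with lookup r j in rⱼ
... | inj₁ a = inj₁ λ v v′ → trans (lookup-subst r v j) (trans (cong [ id , lookup v ]′ rⱼ)
                                    (sym (trans (lookup-subst r v′ j) (cong [ id , lookup v′ ]′ rⱼ))))
... | inj₂ s = inj₂ (s , refl)

firstOcc : ∀ {k e n} (r : PWord k e n) → Canonical r → ∀ s → ∃[ j ] FirstOcc r s j
firstOcc r can s = least (λ j → lookup r j ≡ inj₂ s)
                         (λ j → ⊎-≡-dec FinP._≟_ FinP._≟_ (lookup r j) (inj₂ s))
                         (Any.index occurs) (sym (lookup-index occurs))
  where occurs = Canonical.containsAll can s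

firstOcc-≤ : ∀ {k e n} (r : PWord k e n) {s j j′} → FirstOcc r s j → lookup r j′ ≡ inj₂ s →
             toℕ j ℕ.≤ toℕ j′
firstOcc-≤ r (_ , first) rⱼ′ = ℕP.≮⇒≥ (λ j′<j → first _ j′<j rⱼ′)

module OrderT {k : ℕ} (T : WDSchroeder k) where
  open WDSchroeder T
  private module ⪯ = IsTotalPreorder isTotalPreorder

  Lca≼ : Fin k → Fin k → Fin k → Fin k → Set
  Lca≼ = LcaLe T

  Lca≼-refl : ∀ {a b} → a ≢ b → Lca≼ a b a b
  Lca≼-refl {a} {b} a≢b with tlca-distinct tree a b a≢b
  ... | u , eq = u , u , eq , eq , ⪯.refl

  Lca≼-trans : ∀ {a b c d e f} → Lca≼ a b c d → Lca≼ c d e f → Lca≼ a b e f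
  Lca≼-trans (u , v , ab , cd , u⪯v) (v′ , w , cd′ , ef , v′⪯w) with trans (sym cd) cd′
  ... | refl = u , w , ab , ef , ⪯.trans u⪯v v′⪯w

  Lca≼-total : ∀ {a b c d} → a ≢ b → c ≢ d → Lca≼ a b c d ⊎ Lca≼ c d a b
  Lca≼-total {a} {b} {c} {d} a≢b c≢d
    with tlca-distinct tree a b a≢b | tlca-distinct tree c d c≢d
  ... | u , ab | v , cd = ⊎-map (λ u⪯v → u , v , ab , cd , u⪯v)
                                       (λ v⪯u → v , u , cd , ab , v⪯u) (⪯.total u v)

  Lca≼-swapˡ : ∀ {a b c d} → Lca≼ a b c d → Lca≼ b a c d
  Lca≼-swapˡ {a} {b} (u , v , ab , cd , u⪯v) = u , v , trans (tlca-sym tree b a) ab , cd , u⪯v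

  Lca≼-swapʳ : ∀ {a b c d} → Lca≼ a b c d → Lca≼ a b d c
  Lca≼-swapʳ {c = c} {d} (u , v , ab , cd , u⪯v) = u , v , ab , trans (tlca-sym tree d c) cd , u⪯v

  Lca≼-cong : ∀ {a b c d a′ b′ c′ d′} → a ≡ a′ → b ≡ b′ → c ≡ c′ → d ≡ d′ →
              Lca≼ a b c d → Lca≼ a′ b′ c′ d′
  Lca≼-cong refl refl refl refl l = l

  _⊏_ : ∀ {n} → Rel (Word k n) 0ℓ
  _⊏_ = _≺T_ T

  ⊏-irrefl : ∀ {n} (x : Word k n) → ¬ (x ⊏ x)
  ⊏-irrefl x (i , (xᵢ≢xᵢ , _) , _) = xᵢ≢xᵢ refl

  MaxPos-sym : ∀ {n} (x y : Word k n) i → MaxPos T x y i → MaxPos T y x i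
  MaxPos-sym x y i (xᵢ≢yᵢ , above) =
    xᵢ≢yᵢ ∘ sym , λ j yⱼ≢xⱼ → Lca≼-swapˡ (Lca≼-swapʳ (above j (yⱼ≢xⱼ ∘ sym)))

  ⊏-single : ∀ {n} (x y : Word k n) p → (∀ j → j ≢ p → lookup x j ≡ lookup y j) →
             lookup x p Fin.< lookup y p → x ⊏ y
  ⊏-single x y p same x<y = p , (xₚ≢yₚ , above) , none-before , x<y
    where
    xₚ≢yₚ : lookup x p ≢ lookup y p
    xₚ≢yₚ = FinP.<⇒≢ x<y
    only-p : ∀ j → lookup x j ≢ lookup y j → j ≡ p
    only-p j xⱼ≢yⱼ with j FinP.≟ p
    ... | yes j≡p = j≡p
    ... | no j≢p  = ⊥-elim (xⱼ≢yⱼ (same j j≢p))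
    above : ∀ j → lookup x j ≢ lookup y j →
            Lca≼ (lookup x j) (lookup y j) (lookup x p) (lookup y p)
    above j xⱼ≢yⱼ with only-p j xⱼ≢yⱼ
    ... | refl = Lca≼-refl xₚ≢yₚ
    none-before : ∀ j → j Fin.< p → ¬ MaxPos T x y j
    none-before j j<p (xⱼ≢yⱼ , _) with only-p j xⱼ≢yⱼ
    ... | refl = FinP.<-irrefl refl j<p

  -- Once ⪯_T is decidable on lowest common ancestors of distinct letters,
  -- ⊏ is trichotomous: the first maximal position of two distinct words is
  -- found by a finite search.
  module Trichotomy (lca≼? : ∀ a b c d → a ≢ b → c ≢ d → Dec (Lca≼ a b c d)) where

    MaxPos? : ∀ {n} (x y : Word k n) i → Dec (MaxPos T x y i)
    MaxPos? x y i with lookup x i FinP.≟ lookup y i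
    ... | yes xᵢ≡yᵢ = no (λ m → proj₁ m xᵢ≡yᵢ)
    ... | no xᵢ≢yᵢ  = map′ (xᵢ≢yᵢ ,_) proj₂ (FinP.all? below?)
      where
      below? : ∀ j → Dec (lookup x j ≢ lookup y j →
                          Lca≼ (lookup x j) (lookup y j) (lookup x i) (lookup y i))
      below? j with lookup x j FinP.≟ lookup y j
      ... | yes xⱼ≡yⱼ = yes (λ xⱼ≢yⱼ → ⊥-elim (xⱼ≢yⱼ xⱼ≡yⱼ))
      ... | no xⱼ≢yⱼ  =
        map′ (λ l _ → l) (λ l → l xⱼ≢yⱼ) (lca≼? _ _ _ _ xⱼ≢yⱼ xᵢ≢yᵢ)

    firstMaxPos : ∀ {n} (x y : Word k n) j → lookup x j ≢ lookup y j →
                  ∃[ i ] (MaxPos T x y i × (∀ i′ → i′ Fin.< i → ¬ MaxPos T x y i′))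
    firstMaxPos x y j xⱼ≢yⱼ with maximum Differ Below differ? total
                                   (λ _ _ _ → Lca≼-trans) j xⱼ≢yⱼ
      where
      Differ : _ → Set
      Differ i = lookup x i ≢ lookup y i
      Below : _ → _ → Set
      Below i j = Lca≼ (lookup x i) (lookup y i) (lookup x j) (lookup y j)
      differ? : ∀ i → Dec (Differ i)
      differ? i with lookup x i FinP.≟ lookup y i
      ... | yes eq = no (λ ne → ne eq)
      ... | no ne  = yes ne
      total : ∀ i j → Differ i → Differ j → Below i j ⊎ Below j i
      total _ _ = Lca≼-total
    ... | M , dₘ , above = least (MaxPos T x y) (MaxPos? x y) M (dₘ , above)

    ⊏-trichotomous : ∀ {n} (x y : Word k n) → x ≡ y ⊎ x ⊏ y ⊎ y ⊏ x
    ⊏-trichotomous {n} x y with FinP.all? (λ j → lookup x j FinP.≟ lookup y j)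
    ... | yes same = inj₁ (lookup-ext same)
    ... | no ¬same with FinP.¬∀⟶∃¬ n _ (λ j → lookup x j FinP.≟ lookup y j) ¬same
    ...   | j , xⱼ≢yⱼ with firstMaxPos x y j xⱼ≢yⱼ
    ...     | i , maxᵢ@(xᵢ≢yᵢ , _) , first with FinP.<-cmp (lookup x i) (lookup y i)
    ...       | tri< xᵢ<yᵢ _ _ = inj₂ (inj₁ (i , maxᵢ , first , xᵢ<yᵢ))
    ...       | tri≈ _ xᵢ≡yᵢ _ = ⊥-elim (xᵢ≢yᵢ xᵢ≡yᵢ)
    ...       | tri> _ _ yᵢ<xᵢ =
      inj₂ (inj₂ (i , MaxPos-sym x y i maxᵢ ,
                  (λ i′ i′<i m → first i′ i′<i (MaxPos-sym y x i′ m)) , yᵢ<xᵢ))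

  -- Parameter positions of r carry the letters of
  -- v, v′, and the first occurrences of parameters come in order.
  module Restriction {e n} (r : PWord k e n) (can : Canonical r) (v v′ : Word k e) where
    private
      X = r [ v ]
      Y = r [ v′ ]

      at : ∀ {j s} → lookup r j ≡ inj₂ s → lookup X j ≡ lookup v s × lookup Y j ≡ lookup v′ s
      at rⱼ = lookup-subst-param r v rⱼ , lookup-subst-param r v′ rⱼ

    maxPos-down : ∀ {j s} → lookup r j ≡ inj₂ s → MaxPos T X Y j → MaxPos T v v′ s
    maxPos-down rⱼ (Xⱼ≢Yⱼ , above) = subst₂ _≢_ Xⱼ Yⱼ Xⱼ≢Yⱼ , above′
      where
      Xⱼ = proj₁ (at rⱼ)
      Yⱼ = proj₂ (at rⱼ)
      above′ : ∀ t → lookup v t ≢ lookup v′ t →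
               Lca≼ (lookup v t) (lookup v′ t) (lookup v _) (lookup v′ _)
      above′ t vₜ≢v′ₜ with firstOcc r can t
      ... | jₜ , rⱼₜ , _ with at rⱼₜ
      ...   | Xₜ , Yₜ =
        Lca≼-cong Xₜ Yₜ Xⱼ Yⱼ (above jₜ (subst₂ _≢_ (sym Xₜ) (sym Yₜ) vₜ≢v′ₜ))

    maxPos-up : ∀ {j s} → lookup r j ≡ inj₂ s → MaxPos T v v′ s → MaxPos T X Y j
    maxPos-up rⱼ (vₛ≢v′ₛ , above) = subst₂ _≢_ (sym Xⱼ) (sym Yⱼ) vₛ≢v′ₛ , above′
      where
      Xⱼ = proj₁ (at rⱼ)
      Yⱼ = proj₂ (at rⱼ)
      above′ : ∀ j′ → lookup X j′ ≢ lookup Y j′ →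
               Lca≼ (lookup X j′) (lookup Y j′) (lookup X _) (lookup Y _)
      above′ j′ Xⱼ′≢Yⱼ′ with constant-or-param r j′
      ... | inj₁ agree = ⊥-elim (Xⱼ′≢Yⱼ′ (agree v v′))
      ... | inj₂ (t , rⱼ′) with at rⱼ′
      ...   | Xₜ , Yₜ = Lca≼-cong (sym Xₜ) (sym Yₜ) (sym Xⱼ) (sym Yⱼ)
                                  (above t (subst₂ _≢_ Xₜ Yₜ Xⱼ′≢Yⱼ′))

    lower : X ⊏ Y → v ⊏ v′
    lower (j , maxⱼ , first , Xⱼ<Yⱼ) with constant-or-param r j
    ... | inj₁ agree = ⊥-elim (proj₁ maxⱼ (agree v v′))
    ... | inj₂ (s , rⱼ) = s , maxPos-down rⱼ maxⱼ , first′ , subst₂ Fin._<_ Xⱼ Yⱼ Xⱼ<Yⱼ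
      where
      Xⱼ = proj₁ (at rⱼ)
      Yⱼ = proj₂ (at rⱼ)
      -- an earlier maximal parameter t would first occur before j
      first′ : ∀ t → t Fin.< s → ¬ MaxPos T v v′ t
      first′ t t<s maxₜ with firstOcc r can t | firstOcc r can s
      ... | jₜ , occₜ | jₛ , occₛ =
        first jₜ (ℕP.<-≤-trans (Canonical.ordered can t s jₜ jₛ t<s occₜ occₛ)
                               (firstOcc-≤ r occₛ rⱼ))
              (maxPos-up (proj₁ occₜ) maxₜ)

    raise : v ⊏ v′ → X ⊏ Y
    raise (s , maxₛ , first , vₛ<v′ₛ) with firstOcc r can s
    ... | jₛ , occₛ@(rⱼₛ , _) =
      jₛ , maxPos-up rⱼₛ maxₛ , first′ ,
      subst₂ Fin._<_ (sym (proj₁ (at rⱼₛ))) (sym (proj₂ (at rⱼₛ))) vₛ<v′ₛ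
      where
      -- a maximal position before jₛ carries a parameter t; t < s is excluded by
      -- minimality of s, t = s by the first occurrence, t > s by canonicity
      first′ : ∀ j → j Fin.< jₛ → ¬ MaxPos T X Y j
      first′ j j<jₛ maxⱼ with constant-or-param r j
      ... | inj₁ agree = proj₁ maxⱼ (agree v v′)
      ... | inj₂ (t , rⱼ) with FinP.<-cmp t s
      ...   | tri< t<s _ _ = first t t<s (maxPos-down rⱼ maxⱼ)
      ...   | tri≈ _ refl _ = proj₂ occₛ j j<jₛ rⱼ
      ...   | tri> _ _ s<t with firstOcc r can t
      ...     | jₜ , occₜ = FinP.<-irrefl refl
                  (ℕP.<-≤-trans (Canonical.ordered can s t jₛ jₜ s<t occₛ occₜ)
                                (ℕP.≤-trans (firstOcc-≤ r occₜ rⱼ) (ℕP.<⇒≤ j<jₛ)))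

  restrict-⊏ : ∀ {e n} (r : PWord k e n) → Canonical r → ∀ v v′ →
               Restrict _⊏_ r v v′ ⇔ v ⊏ v′
  restrict-⊏ r can v v′ = mk⇔ lower raise
    where open Restriction r can v v′

-- pinch i : Fin (suc d) → Fin d merges the positions i and i+1.
pinch-punchIn : ∀ {d} (i t : Fin d) → pinch i (punchIn (suc i) t) ≡ t
pinch-punchIn {suc d} i       zero    = refl
pinch-punchIn {suc d} zero    (suc t) = refl
pinch-punchIn {suc d} (suc i) (suc t) = cong suc (pinch-punchIn i t)

pinch-first : ∀ {d} (i : Fin d) (s : Fin (suc d)) t → pinch i s ≡ t →
              toℕ (punchIn (suc i) t) ℕ.≤ toℕ s
pinch-first {suc d} i       zero    t       refl = ℕ.z≤n
pinch-first {suc d} zero    (suc s) zero    refl = ℕ.z≤n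
pinch-first {suc d} zero    (suc s) (suc t) refl = ℕP.≤-refl
pinch-first {suc d} (suc i) (suc s) (suc t) eq   = ℕ.s≤s (pinch-first i s t (FinP.suc-injective eq))

pinch-inject₁ : ∀ {d} (i : Fin d) → pinch i (inject₁ i) ≡ i
pinch-inject₁ {suc d} zero    = refl
pinch-inject₁ {suc d} (suc i) = cong suc (pinch-inject₁ i)

pinch-suc : ∀ {d} (i : Fin d) → pinch i (suc i) ≡ i
pinch-suc {suc d} zero    = refl
pinch-suc {suc d} (suc i) = cong suc (pinch-suc i)

pinch-fibre : ∀ {d} (i : Fin d) s → pinch i s ≡ i → s ≡ inject₁ i ⊎ s ≡ suc i
pinch-fibre {suc d} zero    zero    _  = inj₁ refl
pinch-fibre {suc d} zero    (suc s) eq = inj₂ (cong suc eq)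
pinch-fibre {suc d} (suc i) (suc s) eq =
  ⊎-map (cong suc) (cong suc) (pinch-fibre i s (FinP.suc-injective eq))

punchIn-mono-< : ∀ {n} (j : Fin (suc n)) s t → s Fin.< t → punchIn j s Fin.< punchIn j t
punchIn-mono-< j s t s<t = FinP.≤∧≢⇒< (FinP.punchIn-mono-≤ j s t (ℕP.<⇒≤ s<t))
                                      (FinP.<⇒≢ s<t ∘ FinP.punchIn-injective j s t)

canonical-by : ∀ {k e n} (r : PWord k e n) (φ : Fin e → Fin n) →
  (∀ t → lookup r (φ t) ≡ inj₂ t) →
  (∀ j t → lookup r j ≡ inj₂ t → toℕ (φ t) ℕ.≤ toℕ j) →
  (∀ s t → s Fin.< t → φ s Fin.< φ t) → Canonical r
canonical-by r φ carries earliest increasing = record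
  { containsAll = λ t → subst (_∈ r) (carries t) (∈-lookup (φ t) r)
  ; ordered     = λ s t jₛ jₜ s<t (_ , firstₛ) (rⱼₜ , _) →
      ℕP.≤-<-trans (ℕP.≮⇒≥ (λ φₛ<jₛ → firstₛ (φ s) φₛ<jₛ (carries s)))
                   (ℕP.<-≤-trans (increasing s t s<t) (earliest jₜ t rⱼₜ))
  }

padEntry : ∀ {k e E} → (Fin E → Fin k ⊎ Fin e) → Fin k → ∀ {j} → Dec (j ℕ.< E) → Fin k ⊎ Fin e
padEntry F c (yes j<E) = F (Fin.fromℕ< j<E)
padEntry F c (no _)    = inj₁ c

pad : ∀ {k e E n} → (Fin E → Fin k ⊎ Fin e) → Fin k → PWord k e n
pad {E = E} F c = tabulate (λ j → padEntry F c (toℕ j ℕ.<? E))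

module _ {k e E n : ℕ} (F : Fin E → Fin k ⊎ Fin e) (c : Fin k) where

  private
    lookup-pad : ∀ j → lookup (pad {n = n} F c) j ≡ padEntry F c (toℕ j ℕ.<? E)
    lookup-pad = VecP.lookup∘tabulate _

    entry-inside : ∀ t {j} → j ≡ toℕ t → (j<E? : Dec (j ℕ.< E)) → padEntry F c j<E? ≡ F t
    entry-inside t j≡t (yes j<E) = cong F (FinP.toℕ-injective (trans (FinP.toℕ-fromℕ< j<E) j≡t))
    entry-inside t j≡t (no j≮E)  = ⊥-elim (j≮E (subst (ℕ._< E) (sym j≡t) (FinP.toℕ<n t)))

    entry-param : ∀ {j s} (j<E? : Dec (j ℕ.< E)) → padEntry F c j<E? ≡ inj₂ s →
                  ∃[ t ] (toℕ t ≡ j × F t ≡ inj₂ s)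
    entry-param (yes j<E) eq = Fin.fromℕ< j<E , FinP.toℕ-fromℕ< j<E , eq

  pad-inside : (E≤n : E ℕ.≤ n) → ∀ t → lookup (pad {n = n} F c) (Fin.inject≤ t E≤n) ≡ F t
  pad-inside E≤n t =
    trans (lookup-pad _) (entry-inside t (FinP.toℕ-inject≤ t E≤n) (toℕ (Fin.inject≤ t E≤n) ℕ.<? E))

  pad-param : ∀ j {s} → lookup (pad {n = n} F c) j ≡ inj₂ s →
              ∃[ t ] (toℕ t ≡ toℕ j × F t ≡ inj₂ s)
  pad-param j eq = entry-param (toℕ j ℕ.<? E) (trans (sym (lookup-pad j)) eq)

  pad-canonical : E ℕ.≤ n → (φ : Fin e → Fin E) →
    (∀ t → F (φ t) ≡ inj₂ t) → (∀ s t → F s ≡ inj₂ t → toℕ (φ t) ℕ.≤ toℕ s) →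
    (∀ s t → s Fin.< t → φ s Fin.< φ t) → Canonical (pad {n = n} F c)
  pad-canonical E≤n φ carries earliest increasing =
    canonical-by (pad F c) (λ t → Fin.inject≤ (φ t) E≤n)
      (λ t → trans (pad-inside E≤n (φ t)) (carries t))
      earliest′
      (λ s t s<t → subst₂ ℕ._<_ (sym (FinP.toℕ-inject≤ (φ s) E≤n))
                                (sym (FinP.toℕ-inject≤ (φ t) E≤n)) (increasing s t s<t))
    where
    earliest′ : ∀ j t → lookup (pad F c) j ≡ inj₂ t → toℕ (Fin.inject≤ (φ t) E≤n) ℕ.≤ toℕ j
    earliest′ j t eq with pad-param j eq
    ... | s , s≡j , Fₛ = subst₂ ℕ._≤_ (sym (FinP.toℕ-inject≤ (φ t) E≤n)) s≡j (earliest s t Fₛ)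

pad-subst : ∀ {k e e′ E n} (F : Fin E → Fin k ⊎ Fin e) (G : Fin E → Fin k ⊎ Fin e′) c v v′ →
            (∀ t → [ id , lookup v ]′ (F t) ≡ [ id , lookup v′ ]′ (G t)) →
            pad {n = n} F c [ v ] ≡ pad G c [ v′ ]
pad-subst {E = E} F G c v v′ same = lookup-ext λ j → begin
  lookup (pad F c [ v ]) j
    ≡⟨ lookup-subst (pad F c) v j ⟩
  [ id , lookup v ]′ (lookup (pad F c) j)
    ≡⟨ cong [ id , lookup v ]′ (VecP.lookup∘tabulate _ j) ⟩
  [ id , lookup v ]′ (padEntry F c (toℕ j ℕ.<? E))
    ≡⟨ entries (toℕ j ℕ.<? E) ⟩
  [ id , lookup v′ ]′ (padEntry G c (toℕ j ℕ.<? E))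
    ≡⟨ cong [ id , lookup v′ ]′ (VecP.lookup∘tabulate _ j) ⟨
  [ id , lookup v′ ]′ (lookup (pad G c) j)
    ≡⟨ lookup-subst (pad G c) v′ j ⟨
  lookup (pad G c [ v′ ]) j
    ∎
  where
  open ≡-Reasoning
  entries : ∀ {j} (j<E? : Dec (j ℕ.< E)) →
            [ id , lookup v ]′ (padEntry F c j<E?) ≡ [ id , lookup v′ ]′ (padEntry G c j<E?)
  entries (yes _) = same _
  entries (no _)  = refl

std : ∀ {k e n} → Fin k → PWord k e n
std c = pad inj₂ c

std-canonical : ∀ {k e n} → e ℕ.≤ n → (c : Fin k) → Canonical (std {e = e} {n} c)
std-canonical e≤n c =
  pad-canonical inj₂ c e≤n id (λ _ → refl) (λ { s t refl → ℕP.≤-refl }) (λ _ _ s<t → s<t)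

fixAt : ∀ {k E} → Fin (suc E) → Fin k → Fin (suc E) → Fin k ⊎ Fin E
fixAt j a s with j FinP.≟ s
... | yes _   = inj₁ a
... | no j≢s  = inj₂ (punchOut j≢s)

fix-canonical : ∀ {k E n} → suc E ℕ.≤ n → ∀ j (a c : Fin k) → Canonical (pad {n = n} (fixAt j a) c)
fix-canonical le j a c = pad-canonical (fixAt j a) c le (punchIn j) carries earliest (punchIn-mono-< j)
  where
  carries : ∀ t → fixAt j a (punchIn j t) ≡ inj₂ t
  carries t with j FinP.≟ punchIn j t
  ... | yes j≡ = ⊥-elim (FinP.punchInᵢ≢i j t (sym j≡))
  ... | no _   = cong inj₂ (trans (FinP.punchOut-cong j refl) (FinP.punchOut-punchIn j))
  earliest : ∀ s t → fixAt j a s ≡ inj₂ t → toℕ (punchIn j t) ℕ.≤ toℕ s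
  earliest s t eq with j FinP.≟ s | eq
  ... | no j≢s | refl = ℕP.≤-reflexive (cong toℕ (FinP.punchIn-punchOut j≢s))

fix-subst : ∀ {k E n} j (a c : Fin k) (x : Word k E) →
            pad {n = n} (fixAt j a) c [ x ] ≡ std c [ insertAt x j a ]
fix-subst j a c x = pad-subst (fixAt j a) inj₂ c x (insertAt x j a) same
  where
  same : ∀ t → [ id , lookup x ]′ (fixAt j a t) ≡ lookup (insertAt x j a) t
  same t with j FinP.≟ t
  ... | yes refl = sym (VecP.insertAt-lookup x j a)
  ... | no j≢t   = trans (sym (VecP.insertAt-punchIn x j a (punchOut j≢t)))
                         (cong (lookup (insertAt x j a)) (FinP.punchIn-punchOut j≢t))

dupAt : ∀ {k d} → Fin d → Fin (suc d) → Fin k ⊎ Fin d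
dupAt i s = inj₂ (pinch i s)

dup : ∀ {k d} → Fin d → Word k d → Word k (suc d)
dup i w = tabulate (lookup w ∘ pinch i)

dup-canonical : ∀ {k d n} → suc d ℕ.≤ n → (i : Fin d) (c : Fin k) → Canonical (pad {n = n} (dupAt i) c)
dup-canonical le i c = pad-canonical (dupAt i) c le (punchIn (suc i))
  (λ t → cong inj₂ (pinch-punchIn i t)) (λ { s t refl → pinch-first i s _ refl })
  (punchIn-mono-< (suc i))

dup-subst : ∀ {k d n} (i : Fin d) (c : Fin k) (w : Word k d) →
            pad {n = n} (dupAt i) c [ w ] ≡ std c [ dup i w ]
dup-subst i c w =
  pad-subst (dupAt i) inj₂ c w (dup i w) (λ t → sym (VecP.lookup∘tabulate (lookup w ∘ pinch i) t))

suc≢inject₁ : ∀ {d} (i : Fin d) → suc i ≢ inject₁ i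
suc≢inject₁ zero    ()
suc≢inject₁ (suc i) eq = suc≢inject₁ i (FinP.suc-injective eq)

spare₁ spare₂ : ∀ {d} → Fin (suc (suc (suc d))) → Fin (suc (suc (suc (suc d))))
spare₁ zero    = suc (suc zero)
spare₁ (suc _) = zero
spare₂ zero          = suc (suc (suc zero))
spare₂ (suc zero)    = suc (suc (suc zero))
spare₂ (suc (suc _)) = suc zero

spares-distinct : ∀ {d} (i : Fin (suc (suc (suc d)))) →
  spare₁ i ≢ inject₁ i × spare₁ i ≢ suc i ×
  spare₂ i ≢ inject₁ i × spare₂ i ≢ suc i × spare₂ i ≢ spare₁ i
spares-distinct zero          = (λ ()) , (λ ()) , (λ ()) , (λ ()) , (λ ())
spares-distinct (suc zero)    = (λ ()) , (λ ()) , (λ ()) , (λ ()) , (λ ())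
spares-distinct (suc (suc i)) = (λ ()) , (λ ()) , (λ ()) , (λ ()) , (λ ())

does-true : ∀ {A : Set} (a? : Dec A) → does a? ≡ true → A
does-true (yes a) _ = a

-- The middle hybrid word of the induction step takes v′ at the positions
-- P₁ = inject₁ i and p = spare₁ i of dup, and v elsewhere; B selects them.
module Middle {d} (i : Fin (suc (suc (suc d)))) where
  P₁ P₂ p q : Fin (suc (suc (suc (suc d))))
  P₁ = inject₁ i
  P₂ = suc i
  p  = spare₁ i
  q  = spare₂ i

  private
    distinct = spares-distinct i
    p≢P₁ = proj₁ distinct
    p≢P₂ = proj₁ (proj₂ distinct)
    q≢P₁ = proj₁ (proj₂ (proj₂ distinct))
    q≢P₂ = proj₁ (proj₂ (proj₂ (proj₂ distinct)))
    q≢p  = proj₂ (proj₂ (proj₂ (proj₂ distinct)))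
    selected? : ∀ s → Dec (s ≡ P₁ ⊎ s ≡ p)
    selected? s = (s FinP.≟ P₁) ⊎-dec (s FinP.≟ p)

  B : Fin (suc (suc (suc (suc d)))) → Bool
  B s = does (selected? s)

  P₁≢p : P₁ ≢ p
  P₁≢p = p≢P₁ ∘ sym

  P₂≢q : P₂ ≢ q
  P₂≢q = q≢P₂ ∘ sym

  B-P₁ : B P₁ ≡ true
  B-P₁ = dec-true (selected? P₁) (inj₁ refl)

  B-p : B p ≡ true
  B-p = dec-true (selected? p) (inj₂ refl)

  B-P₂ : B P₂ ≡ false
  B-P₂ = dec-false (selected? P₂) [ suc≢inject₁ i , p≢P₂ ∘ sym ]′

  B-q : B q ≡ false
  B-q = dec-false (selected? q) [ q≢P₁ , q≢p ]′

  early₁ : ∀ j → j Fin.< P₁ → B j ≡ true → pinch i j ≢ i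
  early₁ j j<P₁ Bⱼ with does-true (selected? j) Bⱼ
  ... | inj₁ refl = ⊥-elim (FinP.<-irrefl refl j<P₁)
  ... | inj₂ refl = [ p≢P₁ , p≢P₂ ]′ ∘ pinch-fibre i p

  early₂ : ∀ j → j Fin.< P₂ → B j ≡ false → pinch i j ≢ i
  early₂ j j<P₂ Bⱼ j↦i with pinch-fibre i j j↦i
  ... | inj₁ refl with trans (sym B-P₁) Bⱼ
  ...   | ()
  early₂ j j<P₂ Bⱼ j↦i | inj₂ refl = FinP.<-irrefl refl j<P₂

module Hybrid {k d : ℕ} (T : WDSchroeder k) (v v′ : Word k d) (i : Fin d)
              (maxᵢ : MaxPos T v v′ i) (first : ∀ j → j Fin.< i → ¬ MaxPos T v v′ j)
              (vᵢ<v′ᵢ : lookup v i Fin.< lookup v′ i) where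
  open OrderT T

  H : (Fin (suc d) → Bool) → Word k (suc d)
  H B = tabulate (λ s → if B s then lookup v′ (pinch i s) else lookup v (pinch i s))

  private
    lookup-H : ∀ B s → lookup (H B) s ≡ (if B s then lookup v′ (pinch i s) else lookup v (pinch i s))
    lookup-H B = VecP.lookup∘tabulate _

  H-false : ∀ B s → B s ≡ false → lookup (H B) s ≡ lookup v (pinch i s)
  H-false B s Bₛ = trans (lookup-H B s) (cong (λ b → if b then _ else _) Bₛ)

  H-true : ∀ B s → B s ≡ true → lookup (H B) s ≡ lookup v′ (pinch i s)
  H-true B s Bₛ = trans (lookup-H B s) (cong (λ b → if b then _ else _) Bₛ)

  H-agree : ∀ B B′ s → B s ≡ B′ s → lookup (H B) s ≡ lookup (H B′) s
  H-agree B B′ s same =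
    trans (lookup-H B s) (trans (cong (λ b → if b then _ else _) same) (sym (lookup-H B′ s)))

  H-differ : ∀ B B′ → (∀ s → B s ≡ true → B′ s ≡ true) →
             ∀ s → lookup (H B) s ≢ lookup (H B′) s → B s ≡ false × B′ s ≡ true
  H-differ B B′ B⊆B′ s differ with B s in Bₛ | B′ s in B′ₛ
  ... | false | true  = refl , refl
  ... | false | false = ⊥-elim (differ (H-agree B B′ s (trans Bₛ (sym B′ₛ))))
  ... | true  | true  = ⊥-elim (differ (H-agree B B′ s (trans Bₛ (sym B′ₛ))))
  ... | true  | false with trans (sym (B⊆B′ s Bₛ)) B′ₛ
  ...   | ()

  hybrid-⊏ : ∀ B B′ → (∀ s → B s ≡ true → B′ s ≡ true) →
             ∀ P → pinch i P ≡ i → B P ≡ false → B′ P ≡ true →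
             (∀ j → j Fin.< P → B j ≡ false → B′ j ≡ true → pinch i j ≢ i) → H B ⊏ H B′
  hybrid-⊏ B B′ B⊆B′ P P↦i Bₚ B′ₚ early =
    P , (Xₚ≢Yₚ , above) , none-before , subst₂ Fin._<_ (sym Xₚ) (sym Yₚ) vᵢ<v′ᵢ
    where
    Xₚ : lookup (H B) P ≡ lookup v i
    Xₚ = trans (H-false B P Bₚ) (cong (lookup v) P↦i)
    Yₚ : lookup (H B′) P ≡ lookup v′ i
    Yₚ = trans (H-true B′ P B′ₚ) (cong (lookup v′) P↦i)
    Xₚ≢Yₚ : lookup (H B) P ≢ lookup (H B′) P
    Xₚ≢Yₚ = subst₂ _≢_ (sym Xₚ) (sym Yₚ) (proj₁ maxᵢ)
    -- a differing position j reads v, v′ at pinch i j, which is below i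
    above : ∀ j → lookup (H B) j ≢ lookup (H B′) j →
            Lca≼ (lookup (H B) j) (lookup (H B′) j) (lookup (H B) P) (lookup (H B′) P)
    above j differ with H-differ B B′ B⊆B′ j differ
    ... | Bⱼ , B′ⱼ = Lca≼-cong (sym Xⱼ) (sym Yⱼ) (sym Xₚ) (sym Yₚ)
                               (proj₂ maxᵢ (pinch i j) (subst₂ _≢_ Xⱼ Yⱼ differ))
      where
      Xⱼ = H-false B j Bⱼ
      Yⱼ = H-true B′ j B′ⱼ
    -- an earlier maximal position j would make pinch i j < i maximal for v, v′
    none-before : ∀ j → j Fin.< P → ¬ MaxPos T (H B) (H B′) j
    none-before j j<P (differ , aboveⱼ) with H-differ B B′ B⊆B′ j differ
    ... | Bⱼ , B′ⱼ = first (pinch i j) t<i maxₜ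
      where
      Xⱼ = H-false B j Bⱼ
      Yⱼ = H-true B′ j B′ⱼ
      maxₜ : MaxPos T v v′ (pinch i j)
      maxₜ = subst₂ _≢_ Xⱼ Yⱼ differ ,
             λ u vᵤ≢v′ᵤ → Lca≼-trans (proj₂ maxᵢ u vᵤ≢v′ᵤ)
                                     (Lca≼-cong Xₚ Yₚ Xⱼ Yⱼ (aboveⱼ P Xₚ≢Yₚ))
      t<i : pinch i j Fin.< i
      t<i = FinP.≤∧≢⇒< (subst (pinch i j Fin.≤_) P↦i (FinP.pinch-mono-≤ i (ℕP.<⇒≤ j<P)))
                       (early j j<P Bⱼ B′ⱼ)

-- The induction on the dimension, under the hypotheses of the theorem, for
-- words of length N = m+2 (so that 2-subcubes exist).
module Main {k m : ℕ} (T : WDSchroeder k) (_≺_ : Rel (Word k (suc (suc m))) 0ℓ)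
    (sto : IsStrictTotalOrder _≡_ _≺_) (uniform : Uniform _≺_) (induced : InducedUsual _≺_)
    (two-dim : ∀ (p : PWord k 2 (suc (suc m))) → Canonical p →
       ∀ (a b c d : Fin k) → a Fin.< b → c Fin.< d →
       (Restrict _≺_ p (c ∷ b ∷ []) (d ∷ a ∷ []) ⇔ LcaLe T a b c d)) where

  open OrderT T
  open IsStrictTotalOrder sto using (irrefl; compare; _<?_) renaming (trans to ≺-trans)
  open Equivalence using (to; from)

  N : ℕ
  N = suc (suc m)

  2≤N : 2 ℕ.≤ N
  2≤N = ℕ.s≤s (ℕ.s≤s ℕ.z≤n)

  -- By the 2-subcube hypothesis, comparing lca's amounts to comparing under ≺.
  lca≼-ordered? : ∀ {a b c d} → a Fin.< b → c Fin.< d → Dec (Lca≼ a b c d)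
  lca≼-ordered? {a} {b} {c} {d} a<b c<d = map′ (to crossing) (from crossing) (_ <? _)
    where crossing = two-dim (std a) (std-canonical 2≤N a) a b c d a<b c<d

  lca≼? : ∀ a b c d → a ≢ b → c ≢ d → Dec (Lca≼ a b c d)
  lca≼? a b c d a≢b c≢d with FinP.<-cmp a b | FinP.<-cmp c d
  ... | tri≈ _ a≡b _ | _            = ⊥-elim (a≢b a≡b)
  ... | _            | tri≈ _ c≡d _ = ⊥-elim (c≢d c≡d)
  ... | tri< a<b _ _ | tri< c<d _ _ = lca≼-ordered? a<b c<d
  ... | tri< a<b _ _ | tri> _ _ d<c = map′ Lca≼-swapʳ Lca≼-swapʳ (lca≼-ordered? a<b d<c)
  ... | tri> _ _ b<a | tri< c<d _ _ = map′ Lca≼-swapˡ Lca≼-swapˡ (lca≼-ordered? b<a c<d)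
  ... | tri> _ _ b<a | tri> _ _ d<c =
    map′ (Lca≼-swapˡ ∘ Lca≼-swapʳ) (Lca≼-swapˡ ∘ Lca≼-swapʳ) (lca≼-ordered? b<a d<c)

  open Trichotomy lca≼?

  Faithful : ∀ {e} → PWord k e N → Word k e → Word k e → Set
  Faithful r v v′ = Restrict _≺_ r v v′ ⇔ v ⊏ v′

  transfer : ∀ {e} (q r : PWord k e N) → Canonical q → Canonical r →
             ∀ v v′ → Faithful q v v′ → Faithful r v v′
  transfer q r q-can r-can v v′ = ⇔.trans (uniform _ r q r-can q-can v v′)

  faithful-from : ∀ {e} (r : PWord k e N) → (∀ v v′ → v ⊏ v′ → Restrict _≺_ r v v′) →
                  ∀ v v′ → Faithful r v v′
  faithful-from r incl v v′ = mk⇔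
    (included-trichotomous _⊏_ (Restrict _≺_ r) (λ _ → irrefl refl) (λ _ _ _ → ≺-trans)
                           ⊏-trichotomous incl v v′)
    (incl v v′)

  Standard : ℕ → Set
  Standard e = ∀ (c : Fin k) (v v′ : Word k e) → Faithful (std c) v v′

  -- A coordinate j where x and y agree can be fixed: the pair then lives in the
  -- subcube of pad (fixAt j a) c, one dimension lower.
  fixing : ∀ {E} → suc E ℕ.≤ N → ∀ c (x y : Word k (suc E)) j → lookup x j ≡ lookup y j →
           Faithful (std c) (removeAt x j) (removeAt y j) → Faithful (std c) x y
  -- std[x] ≺ std[y] ⇔ F[x′] ≺ F[y′] ⇔ x′ ⊏ y′ ⇔ F[x′] ⊏ F[y′] ⇔ std[x] ⊏ std[y] ⇔ x ⊏ y
  fixing le c x y j xⱼ≡yⱼ faithful =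
    subst₂ (λ X Y → X ≺ Y ⇔ x ⊏ y) x-fixed y-fixed
      (⇔.trans (transfer (std c) F (std-canonical (ℕP.≤-trans (ℕP.n≤1+n _) le) c) F-can
                         x′ y′ faithful)
               (⇔.trans (⇔.sym (restrict-⊏ F F-can x′ y′))
                        (subst₂ (λ X Y → X ⊏ Y ⇔ x ⊏ y) (sym x-fixed) (sym y-fixed)
                                (restrict-⊏ (std c) (std-canonical le c) x y))))
    where
    x′ = removeAt x j
    y′ = removeAt y j
    F = pad (fixAt j (lookup x j)) c
    F-can = fix-canonical le j (lookup x j) c
    x-fixed : F [ x′ ] ≡ std c [ x ]
    x-fixed = trans (fix-subst j _ c x′) (cong (std c [_]) (VecP.insertAt-removeAt x j))
    y-fixed : F [ y′ ] ≡ std c [ y ]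
    y-fixed = trans (fix-subst j _ c y′)
                    (cong (std c [_]) (trans (cong (insertAt y′ j) xⱼ≡yⱼ) (VecP.insertAt-removeAt y j)))

  agree₁ : ∀ {E} → Standard E → suc E ℕ.≤ N → ∀ c (x y : Word k (suc E)) j →
           lookup x j ≡ lookup y j → Faithful (std c) x y
  agree₁ standard le c x y j xⱼ≡yⱼ =
    fixing le c x y j xⱼ≡yⱼ (standard c (removeAt x j) (removeAt y j))

  agree₂ : ∀ {E} → Standard E → suc (suc E) ℕ.≤ N →
           ∀ c (x y : Word k (suc (suc E))) j l → j ≢ l →
           lookup x j ≡ lookup y j → lookup x l ≡ lookup y l → Faithful (std c) x y
  agree₂ standard le c x y j l j≢l xⱼ≡yⱼ xₗ≡yₗ =
    fixing le c x y j xⱼ≡yⱼ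
      (agree₁ standard (ℕP.≤-trans (ℕP.n≤1+n _) le) c (removeAt x j) (removeAt y j) (punchOut j≢l)
        (trans (VecP.removeAt-punchOut x j≢l) (trans xₗ≡yₗ (sym (VecP.removeAt-punchOut y j≢l)))))

  standard₁ : Standard 1
  standard₁ c = faithful-from (std c) λ { (a ∷ []) (b ∷ []) (zero , _ , _ , a<b) →
                  from (induced (std c) (std-canonical (ℕ.s≤s ℕ.z≤n) c) a b) a<b }

  -- dimension 2: pairs agreeing in a coordinate reduce to dimension 1, pairs
  -- increasing in both coordinates go through an intermediate word, and
  -- crossing pairs are the 2-subcube hypothesis
  standard₂ : Standard 2
  standard₂ c = faithful-from S increasing
    where
    S : PWord k 2 N
    S = std c
    std-can = std-canonical 2≤N c
    agree = agree₁ standard₁ 2≤N c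

    -- increase the first letter, then the second: each step fixes a coordinate
    both : ∀ {x₀ x₁ y₀ y₁} → x₀ Fin.< y₀ → x₁ Fin.< y₁ →
           Restrict _≺_ S (x₀ ∷ x₁ ∷ []) (y₀ ∷ y₁ ∷ [])
    both {x₀} {x₁} {y₀} {y₁} x₀<y₀ x₁<y₁ =
      ≺-trans (from (agree (x₀ ∷ x₁ ∷ []) (y₀ ∷ x₁ ∷ []) (suc zero) refl)
                    (⊏-single (x₀ ∷ x₁ ∷ []) (y₀ ∷ x₁ ∷ []) zero same-second x₀<y₀))
              (from (agree (y₀ ∷ x₁ ∷ []) (y₀ ∷ y₁ ∷ []) zero refl)
                    (⊏-single (y₀ ∷ x₁ ∷ []) (y₀ ∷ y₁ ∷ []) (suc zero) same-first x₁<y₁))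
      where
      same-second : ∀ j → j ≢ zero → lookup (x₀ ∷ x₁ ∷ []) j ≡ lookup (y₀ ∷ x₁ ∷ []) j
      same-second zero       0≢0 = ⊥-elim (0≢0 refl)
      same-second (suc zero) _   = refl
      same-first : ∀ j → j ≢ suc zero → lookup (y₀ ∷ x₁ ∷ []) j ≡ lookup (y₀ ∷ y₁ ∷ []) j
      same-first zero       _   = refl
      same-first (suc zero) 1≢1 = ⊥-elim (1≢1 refl)

    increasing : ∀ v v′ → v ⊏ v′ → Restrict _≺_ S v v′
    increasing v@(x₀ ∷ x₁ ∷ []) v′@(y₀ ∷ y₁ ∷ []) v⊏v′@(zero , (_ , above) , _ , x₀<y₀)
      with FinP.<-cmp x₁ y₁
    ... | tri≈ _ x₁≡y₁ _ = from (agree v v′ (suc zero) x₁≡y₁) v⊏v′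
    ... | tri< x₁<y₁ _ _ = both x₀<y₀ x₁<y₁
    ... | tri> _ _ y₁<x₁ = from (two-dim S std-can y₁ x₁ x₀ y₀ y₁<x₁ x₀<y₀)
                                (Lca≼-swapˡ (above (suc zero) (FinP.<⇒≢ y₁<x₁ ∘ sym)))
    increasing v@(x₀ ∷ x₁ ∷ []) v′@(y₀ ∷ y₁ ∷ []) v⊏v′@(suc zero , _ , first , x₁<y₁)
      with FinP.<-cmp x₀ y₀
    ... | tri≈ _ x₀≡y₀ _ = from (agree v v′ zero x₀≡y₀) v⊏v′
    ... | tri< x₀<y₀ _ _ = both x₀<y₀ x₁<y₁
    ... | tri> _ _ y₀<x₀ with compare (S [ v ]) (S [ v′ ])
    ...   | tri< v≺v′ _ _ = v≺v′
    ...   | tri≈ _ v≡v′ _ = ⊥-elim (⊏-irrefl (S [ v ]) (subst (S [ v ] ⊏_) (sym v≡v′)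
                                                      (from (restrict-⊏ S std-can v v′) v⊏v′)))
    -- v′ ≺ v would make position 0 maximal, although it comes first
    ...   | tri> _ _ v′≺v =
      ⊥-elim (first zero (ℕ.s≤s ℕ.z≤n) (FinP.<⇒≢ y₀<x₀ ∘ sym , above₀))
      where
      above₀ : ∀ j → lookup v j ≢ lookup v′ j → Lca≼ (lookup v j) (lookup v′ j) x₀ y₀
      above₀ zero          x₀≢y₀ = Lca≼-refl x₀≢y₀
      above₀ (suc zero) _ =
        Lca≼-swapʳ (to (two-dim S std-can x₁ y₁ y₀ x₀ x₁<y₁ y₀<x₀) v′≺v)

  -- dimension e+1 ≥ 3 (needs e+2 ≤ N): duplicate the decisive coordinate i and
  -- pass from dup i v to dup i v′ through the hybrid word Z, which takes v′ at
  -- positions inject₁ i and spare₁ i; each step agrees in two coordinates.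
  standard-step : ∀ d → suc (suc (suc (suc d))) ℕ.≤ N → Standard (suc (suc d)) →
                  Standard (suc (suc (suc d)))
  standard-step d le standard c = faithful-from (std c) increasing
    where
    increasing : ∀ v v′ → v ⊏ v′ → Restrict _≺_ (std c) v v′
    increasing v v′ (i , maxᵢ , first , vᵢ<v′ᵢ) =
      from (uniform _ (std c) (pad (dupAt i) c) (std-canonical (ℕP.≤-trans (ℕP.n≤1+n _) le) c)
                    (dup-canonical le i c) v v′)
           (subst₂ _≺_ (sym (dup-subst i c v)) (sym (dup-subst i c v′)) (≺-trans X≺Z Z≺Y))
      where
      open Hybrid T v v′ i maxᵢ first vᵢ<v′ᵢ
      open Middle i
      X = H (λ _ → false)
      Z = H B
      Y = H (λ _ → true)
      X≺Z : (std c [ X ]) ≺ (std c [ Z ])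
      X≺Z = from (agree₂ standard le c X Z P₂ q P₂≢q
                         (H-agree (λ _ → false) B P₂ (sym B-P₂)) (H-agree (λ _ → false) B q (sym B-q)))
                 (hybrid-⊏ (λ _ → false) B (λ _ ()) P₁ (pinch-inject₁ i) refl B-P₁
                           (λ j j<P₁ _ → early₁ j j<P₁))
      Z≺Y : (std c [ Z ]) ≺ (std c [ Y ])
      Z≺Y = from (agree₂ standard le c Z Y P₁ p P₁≢p
                         (H-agree B (λ _ → true) P₁ B-P₁) (H-agree B (λ _ → true) p B-p))
                 (hybrid-⊏ B (λ _ → true) (λ _ _ → refl) P₂ (pinch-suc i) B-P₂ refl
                           (λ j j<P₂ Bⱼ _ → early₂ j j<P₂ Bⱼ))

  standard : ∀ d → suc (suc d) ℕ.≤ N → Standard (suc d)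
  standard ℕ.zero             _  = standard₁
  standard (suc ℕ.zero)       _  = standard₂
  standard (suc (suc d))      le = standard-step d le (standard (suc d) (ℕP.≤-trans (ℕP.n≤1+n _) le))

lemma11 : ∀ {k m : ℕ} (T : WDSchroeder k) (_≺_ : Rel (Word k (suc m)) 0ℓ) →
    IsStrictTotalOrder _≡_ _≺_ →
    Uniform _≺_ →
    InducedUsual _≺_ →
    (∀ (p : PWord k 2 (suc m)) → Canonical p →
       ∀ (a b c d : Fin k) → a Fin.< b → c Fin.< d →
       (Restrict _≺_ p (c ∷ b ∷ []) (d ∷ a ∷ []) ⇔ LcaLe T a b c d)) →
    ∀ (p : PWord k m (suc m)) → Canonical p →
    ∀ (w w′ : Word k m) → Restrict _≺_ p w w′ ⇔ Restrict (_≺T_ T) p w w′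
-- a 0-subcube is a single word, on which both orders are empty
lemma11 {m = ℕ.zero} T _≺_ sto _ _ _ p _ [] [] =
  mk⇔ (⊥-elim ∘ IsStrictTotalOrder.irrefl sto refl) (⊥-elim ∘ OrderT.⊏-irrefl T (p [ [] ]))
lemma11 {m = suc m} T _≺_ sto uniform induced two-dim p p-can w w′ =
  ⇔.trans (transfer (std c) p (std-canonical (ℕP.n≤1+n _) c) p-can w w′ (standard m ℕP.≤-refl c w w′))
          (⇔.sym (restrict-⊏ p p-can w w′))
  where
  open Main T _≺_ sto uniform induced two-dim
  open OrderT T using (restrict-⊏)
  -- any letter serves to pad the standard word
  c = lookup w zero
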